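{- Let $G=(V,\mathit{lab},\mathit{args},r)$ be a $\lambda$-term-graph over $\Sigma^\lambda_{12}$ with abstraction-prefix function $P$. (i) $G$ is eager-scope if and only if the following holds. For all $w,v\in V$ and $p,q\in V^*$ with $P(w)=pvq$ and $\mathit{lab}(w)\ne S$, there exist $n\in\mathbb N$ and vertices $w=w_0\rightarrowtail w_1\rightarrowtail\cdots\rightarrowtail w_n\rightarrowtail v$ with $\mathit{lab}(w_n)=0$ and $pv\le P(w_i)$ for all $0\le i\le n$. (ii) $G$ is fully back-linked if and only if the following holds. For all $w,v\in V$ and $p,q\in V^*$ with $P(w)=pvq$, there exist $n\in\mathbb N$ and vertices $w=w_0\rightarrowtail w_1\rightarrowtail\cdots\rightarrowtail w_n\rightarrowtail v$ with $pv\le P(w_i)$ for all $0\le i\le n$.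
   Context: Term graphs. A term graph over a signature $\Sigma$ is a tuple $(V,\mathit{lab},\mathit{args},r)$, where: - $\mathit{args}(v)\in V^*$ has length equal to the arity of $\mathit{lab}(v)$; - every vertex is reachable from the root $r$. Write $w\rightarrowtail_kw'$ if $w'$ is the $k$-th entry (from $0$) of $\mathit{args}(w)$, and $w\rightarrowtail w'$ if this holds for some $k$. Notation. $\Sigma^\lambda_{12}=\{@,\lambda,0,S\}$ with arities $2,1,1,2$. For words: $\epsilon$ is empty, juxtaposition is concatenation, $\le$ is the prefix order. $\lambda$-term-graphs. A $\lambda$-term-graph over $\Sigma^\lambda_{12}$ is a term graph over $\Sigma^\lambda_{12}$ admitting $P:V\to V^*$ with: - $P(r)=\epsilon$; - $\lambda$-vertex $w\rightarrowtail_0w_0$ implies $P(w_0)=P(w)w$; - $@$-vertex $w\rightarrowtail_kw_k$ implies $P(w_k)=P(w)$; - $0$-vertex $w$ implies $P(w)\ne\epsilon$; - $0$-vertex $w\rightarrowtail_0w_0$ implies $w_0$ labelled $\lambda$ and $P(w_0)w_0=P(w)$; - $S$-vertex $w\rightarrowtail_0w_0$ implies $P(w_0)v=P(w)$ for some $v$; - $S$-vertex $w\rightarrowtail_1w_1$ implies $w_1$ labelled $\lambda$ and $P(w_1)w_1=P(w)$. Such a $P$ is unique, and is called the abstraction-prefix function of $G$. Eager-scope. $G$ is eager-scope if, for all $w,v$ and $p$ with $P(w)=pv$ and $w$ not labelled $S$, there exist $w=w_0\rightarrowtail\cdots\rightarrowtail w_n\rightarrowtail_0 v$ with $w_n$ labelled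 $0$ and $pv\le P(w_i)$ for $1\le i\le n-1$. Fully back-linked. $G$ is fully back-linked if, for all $w,v,p$ with $P(w)=pv$, there exist $w=w_0\rightarrowtail\cdots\rightarrowtail w_n\rightarrowtail v$ with $pv\le P(w_i)$ for $0\le i\le n$. -}

module Defs where

open import Data.Nat using (ℕ; zero; suc; _≤_; _<_)
open import Data.Fin using (Fin; toℕ)
open import Data.Vec using (Vec; lookup)
open import Data.List using (List; []; _∷_; _++_; [_])
open import Data.Product using (Σ; ∃; _×_; _,_)
open import Relation.Binary.PropositionalEquality using (_≡_; _≢_)

data Lab : Set where
  app lam zer S : Lab

arity : Lab → ℕ
arity app = 2
arity lam = 1
arity zer = 1
arity S   = 2

_≼_ : ∀ {A : Set} → List A → List A → Set
xs ≼ ys = ∃ λ s → xs ++ s ≡ ys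

module _ {V : Set} (lab : V → Lab) (args : (v : V) → Vec V (arity (lab v))) where

  Edge : V → ℕ → V → Set
  Edge w k w' = Σ (Fin (arity (lab w))) λ k' → toℕ k' ≡ k × lookup (args w) k' ≡ w'

  AnyEdge : V → V → Set
  AnyEdge w w' = ∃ λ k → Edge w k w'

  data Reachable (r : V) : V → Set where
    here : Reachable r r
    step : ∀ {u v} → Reachable r u → AnyEdge u v → Reachable r v

record TermGraph : Set₁ where
  field
    V     : Set
    lab   : V → Lab
    args  : (v : V) → Vec V (arity (lab v))
    root  : V
    reach : ∀ v → Reachable lab args root v

  _↣⟨_⟩_ : V → ℕ → V → Set
  w ↣⟨ k ⟩ w' = Edge lab args w k w'

  _↣_ : V → V → Set
  w ↣ w' = AnyEdge lab args w w'

module _ (G : TermGraph) where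
  open TermGraph G

  -- P is an abstraction-prefix function for G
  -- (G is a λ-term-graph iff such a P exists; it is then unique)
  record IsAbsPrefix (P : V → List V) : Set where
    field
      root-ε   : P root ≡ []
      lam-0    : ∀ w w₀ → lab w ≡ lam → w ↣⟨ 0 ⟩ w₀ → P w₀ ≡ P w ++ [ w ]
      app-k    : ∀ w k wₖ → lab w ≡ app → w ↣⟨ k ⟩ wₖ → P wₖ ≡ P w
      zer-ne   : ∀ w → lab w ≡ zer → P w ≢ []
      zer-0    : ∀ w w₀ → lab w ≡ zer → w ↣⟨ 0 ⟩ w₀ → lab w₀ ≡ lam × P w₀ ++ [ w₀ ] ≡ P w
      S-0      : ∀ w w₀ → lab w ≡ S → w ↣⟨ 0 ⟩ w₀ → ∃ λ v → P w₀ ++ [ v ] ≡ P w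
      S-1      : ∀ w w₁ → lab w ≡ S → w ↣⟨ 1 ⟩ w₁ → lab w₁ ≡ lam × P w₁ ++ [ w₁ ] ≡ P w

  -- A path w = ws 0 ↣ ws 1 ↣ ⋯ ↣ ws n (only the values ws 0 … ws n matter)
  IsPath : V → ℕ → (ℕ → V) → Set
  IsPath w n ws = ws 0 ≡ w × (∀ i → i < n → ws i ↣ ws (suc i))

  module _ (P : V → List V) where

    EagerScope : Set
    EagerScope = ∀ w v p → P w ≡ p ++ [ v ] → lab w ≢ S →
      ∃ λ n → ∃ λ ws → IsPath w n ws × ws n ↣⟨ 0 ⟩ v × lab (ws n) ≡ zer ×
        (∀ i → 1 ≤ i → suc i ≤ n → (p ++ [ v ]) ≼ P (ws i))

    FullyBackLinked : Set
    FullyBackLinked = ∀ w v p → P w ≡ p ++ [ v ] →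
      ∃ λ n → ∃ λ ws → IsPath w n ws × ws n ↣ v ×
        (∀ i → i ≤ n → (p ++ [ v ]) ≼ P (ws i))

    EagerScopeCond : Set
    EagerScopeCond = ∀ w v p q → P w ≡ p ++ [ v ] ++ q → lab w ≢ S →
      ∃ λ n → ∃ λ ws → IsPath w n ws × ws n ↣ v × lab (ws n) ≡ zer ×
        (∀ i → i ≤ n → (p ++ [ v ]) ≼ P (ws i))

    FullyBackLinkedCond : Set
    FullyBackLinkedCond = ∀ w v p q → P w ≡ p ++ [ v ] ++ q →
      ∃ λ n → ∃ λ ws → IsPath w n ws × ws n ↣ v ×
        (∀ i → i ≤ n → (p ++ [ v ]) ≼ P (ws i))

-- The abstraction prefix of every vertex is a chain: if P(w) = a v b then P(v) = a, because P
-- grows only by appending the λ-vertex just passed and otherwise shrinks to a prefix. Hence for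
-- P(w) = p v q u the defining property, applied to the innermost binder u, yields a walk (staying
-- below p v q u) to a vertex pointing at u, and P(u) = p v q; induction on q, from its right end,
-- concatenates these walks into one from w to a vertex pointing at v. For eager scope the walk
-- ends in a 0-vertex pointing at u, so u is a λ-vertex and the induction hypothesis applies to it.
module Submission where

open import Defs
open import Data.List using (List; []; _∷_; _++_; [_]; _∷ʳ_)
open import Data.List.Properties using (++-assoc; ++-identityʳ; ∷ʳ-injective)
open import Data.List.Reverse using (Reverse; []; _∶_∶ʳ_; reverseView)
open import Data.Product using (_×_; _,_; ∃; proj₁; proj₂)
open import Data.Sum using (_⊎_; inj₁; inj₂)
open import Data.Nat using (ℕ; zero; suc; _≤_; _<_; z≤n; s≤s)
open import Data.Nat.Properties using (m≤n⇒m<n∨m≡n; <⇒≤)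
open import Data.Fin using (Fin; toℕ; zero; suc)
open import Relation.Binary.PropositionalEquality using (_≡_; _≢_; refl; sym; trans; cong; subst)
open import Relation.Unary using (Pred; _⊆_)
open import Function.Base using (id)
open import Function.Bundles using (_⇔_; mk⇔)

≼-trans : ∀ {A : Set} {xs ys zs : List A} → xs ≼ ys → ys ≼ zs → xs ≼ zs
≼-trans {xs = xs} (s , xs++s≡ys) (t , ys++t≡zs) =
  s ++ t , trans (sym (++-assoc xs s t)) (trans (cong (_++ t) xs++s≡ys) ys++t≡zs)

∷ʳ≼∷ : ∀ {A : Set} (p : List A) v q → (p ∷ʳ v) ≼ (p ++ v ∷ q)
∷ʳ≼∷ p v q = q , ++-assoc p [ v ] q

module _ (G : TermGraph) where
  open TermGraph G

  unary-edge : ∀ {w w'} → arity (lab w) ≡ 1 → w ↣ w' → w ↣⟨ 0 ⟩ w'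
  unary-edge unary (_ , k , _ , e) = k , index unary k , e
    where
    index : ∀ {l} → arity l ≡ 1 → (k : Fin (arity l)) → toℕ k ≡ 0
    index {app} ()
    index {S}   ()
    index {lam} _ zero = refl
    index {zer} _ zero = refl

  S-edge : ∀ {w w'} → lab w ≡ S → w ↣ w' → w ↣⟨ 0 ⟩ w' ⊎ w ↣⟨ 1 ⟩ w'
  S-edge labw (_ , k , _ , e) with index labw k
    where
    index : ∀ {l} → l ≡ S → (k : Fin (arity l)) → toℕ k ≡ 0 ⊎ toℕ k ≡ 1
    index refl zero          = inj₁ refl
    index refl (suc zero)    = inj₂ refl
    index refl (suc (suc ()))
  ... | inj₁ k≡0 = inj₁ (k , k≡0 , e)
  ... | inj₂ k≡1 = inj₂ (k , k≡1 , e)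

  data Walk (Q E : Pred V _) : V → Set where
    end  : ∀ {w} → Q w → E w → Walk Q E w
    cons : ∀ {w w'} → Q w → w ↣ w' → Walk Q E w' → Walk Q E w

  Walk-map : ∀ {Q Q' E E' w} → Q ⊆ Q' → E ⊆ E' → Walk Q E w → Walk Q' E' w
  Walk-map f g (end q e)    = end (f q) (g e)
  Walk-map f g (cons q e r) = cons (f q) e (Walk-map f g r)

  Walk-++ : ∀ {Q E u w} → Walk Q (_↣ u) w → Walk Q E u → Walk Q E w
  Walk-++ (end q e)    s = cons q e s
  Walk-++ (cons q e r) s = cons q e (Walk-++ r s)

  Walk-last : ∀ {Q E w} → Walk Q E w → ∃ E
  Walk-last (end _ e)    = _ , e
  Walk-last (cons _ _ r) = Walk-last r

  Walk⇒path : ∀ {Q E w} → Walk Q E w →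
    ∃ λ n → ∃ λ ws → IsPath G w n ws × E (ws n) × (∀ i → i ≤ n → Q (ws i))
  Walk⇒path {w = w} (end q e) = 0 , (λ _ → w) , (refl , λ _ ()) , e , λ { zero _ → q }
  Walk⇒path {Q} {w = w} (cons q w↣w' r) with Walk⇒path r
  ... | n , ws , (ws0≡w' , steps) , e , qs = suc n , ws′ , (refl , steps′) , e , qs′
    where
    ws′ : ℕ → V
    ws′ zero    = w
    ws′ (suc i) = ws i
    steps′ : ∀ i → i < suc n → ws′ i ↣ ws′ (suc i)
    steps′ zero    _       = subst (w ↣_) (sym ws0≡w') w↣w'
    steps′ (suc i) (s≤s p) = steps i p
    qs′ : ∀ i → i ≤ suc n → Q (ws′ i)
    qs′ zero    _       = q
    qs′ (suc i) (s≤s p) = qs i p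

  path⇒Walk : ∀ {Q E w} n ws → IsPath G w n ws →
    (∀ i → i ≤ n → Q (ws i)) → E (ws n) → Walk Q E w
  path⇒Walk zero    ws (refl , _)     qs e = end (qs 0 z≤n) e
  path⇒Walk (suc n) ws (refl , steps) qs e =
    cons (qs 0 z≤n) (steps 0 (s≤s z≤n))
      (path⇒Walk n (λ i → ws (suc i)) (refl , λ i p → steps (suc i) (s≤s p))
        (λ i p → qs (suc i) (s≤s p)) e)

module _ (G : TermGraph) (P : TermGraph.V G → List (TermGraph.V G)) (AP : IsAbsPrefix G P) where
  open TermGraph G
  open IsAbsPrefix AP

  Nested : List V → Set
  Nested l = ∀ a x b → l ≡ a ++ x ∷ b → P x ≡ a

  Nested-++ : ∀ l m → Nested (l ++ m) → Nested l
  Nested-++ l m nested a x b l≡ = nested a x (b ++ m) (trans (cong (_++ m) l≡) (++-assoc a (x ∷ b) m))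

  Nested-∷ʳ : ∀ l u → Nested l → P u ≡ l → Nested (l ∷ʳ u)
  Nested-∷ʳ l u nested Pu≡l a x b l∷ʳu≡ = go b (reverseView b) l∷ʳu≡
    where
    go : ∀ b → Reverse b → l ∷ʳ u ≡ a ++ x ∷ b → P x ≡ a
    go .[] [] eq with ∷ʳ-injective l a eq
    ... | l≡a , refl = trans Pu≡l l≡a
    go .(b′ ∷ʳ y) (b′ ∶ _ ∶ʳ y) eq =
      nested a x b′ (proj₁ (∷ʳ-injective l (a ++ x ∷ b′) (trans eq (sym (++-assoc a (x ∷ b′) [ y ])))))

  Nested-reachable : ∀ {x} → Reachable lab args root x → Nested (P x)
  Nested-reachable here rewrite root-ε = λ { [] _ _ () ; (_ ∷ _) _ _ () }
  Nested-reachable {x} (step {u} r u↣x) = byLabel (lab u) refl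
    where
    IH : Nested (P u)
    IH = Nested-reachable r
    byLabel : ∀ l → lab u ≡ l → Nested (P x)
    byLabel app labu = subst Nested (sym (app-k u _ x labu (proj₂ u↣x))) IH
    byLabel lam labu =
      subst Nested (sym (lam-0 u x labu (unary-edge G (cong arity labu) u↣x))) (Nested-∷ʳ (P u) u IH refl)
    byLabel zer labu =
      Nested-++ (P x) [ x ] (subst Nested (sym (proj₂ (zer-0 u x labu (unary-edge G (cong arity labu) u↣x)))) IH)
    byLabel S labu with S-edge G labu u↣x
    ... | inj₁ e₀ = let v , Px∷ʳv≡Pu = S-0 u x labu e₀ in
                    Nested-++ (P x) [ v ] (subst Nested (sym Px∷ʳv≡Pu) IH)
    ... | inj₂ e₁ = Nested-++ (P x) [ x ] (subst Nested (sym (proj₂ (S-1 u x labu e₁))) IH)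

  P-entry : ∀ {w} a x b → P w ≡ a ++ x ∷ b → P x ≡ a
  P-entry {w} = Nested-reachable (reach w)

  Below : List V → Pred V _
  Below l x = l ≼ P x

  Below-∷ʳ : ∀ p v q u → Below ((p ++ v ∷ q) ∷ʳ u) ⊆ Below (p ∷ʳ v)
  Below-∷ʳ p v q u = ≼-trans (subst ((p ∷ʳ v) ≼_) (sym (++-assoc p (v ∷ q) [ u ])) (∷ʳ≼∷ p v (q ∷ʳ u)))

  reassoc : ∀ {w} p v q u → P w ≡ p ++ v ∷ (q ∷ʳ u) → P w ≡ (p ++ v ∷ q) ∷ʳ u
  reassoc p v q u eq = trans eq (sym (++-assoc p (v ∷ q) [ u ]))

  FBL-walk : FullyBackLinked G P → ∀ {w v} p q → P w ≡ p ++ v ∷ q → Walk G (Below (p ∷ʳ v)) (_↣ v) w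
  FBL-walk F p q = go q (reverseView q)
    where
    fromFBL : ∀ {w v} p → P w ≡ p ∷ʳ v → Walk G (Below (p ∷ʳ v)) (_↣ v) w
    fromFBL {w} p eq with F w _ p eq
    ... | n , ws , path , e , below = path⇒Walk G n ws path below e
    go : ∀ {w v} q → Reverse q → P w ≡ p ++ v ∷ q → Walk G (Below (p ∷ʳ v)) (_↣ v) w
    go .[] [] eq = fromFBL p eq
    go {w} {v} .(q ∷ʳ u) (q ∶ rq ∶ʳ u) eq =
      Walk-++ G (Walk-map G (Below-∷ʳ p v q u) id (fromFBL (p ++ v ∷ q) eq′))
        (go q rq (P-entry (p ++ v ∷ q) u [] eq′))
      where
      eq′ : P w ≡ (p ++ v ∷ q) ∷ʳ u
      eq′ = reassoc p v q u eq

  ZeroEdgeTo : V → Pred V _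
  ZeroEdgeTo v z = z ↣⟨ 0 ⟩ v × lab z ≡ zer

  -- Eager scope only constrains the inner vertices; both ends lie below p v by the prefix equations.
  ES-walk : EagerScope G P → ∀ {w v} p → P w ≡ p ∷ʳ v → lab w ≢ S → Walk G (Below (p ∷ʳ v)) (ZeroEdgeTo v) w
  ES-walk E {w} {v} p eq labw≢S with E w v p eq labw≢S
  ... | n , ws , path@(ws0≡w , _) , e , labz , inner = path⇒Walk G n ws path below (e , labz)
    where
    below-last : Below (p ∷ʳ v) (ws n)
    below-last = [] , trans (++-identityʳ _)
      (trans (cong (_∷ʳ v) (sym (P-entry p v [] eq))) (proj₂ (zer-0 (ws n) v labz e)))
    below : ∀ i → i ≤ n → Below (p ∷ʳ v) (ws i)
    below zero    _ = [] , trans (++-identityʳ _) (trans (sym eq) (cong P (sym ws0≡w)))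
    below (suc i) 1+i≤n with m≤n⇒m<n∨m≡n 1+i≤n
    ... | inj₁ 1+i<n = inner (suc i) (s≤s z≤n) 1+i<n
    ... | inj₂ refl  = below-last

  ES-cond-walk : EagerScope G P → ∀ {w v} p q → P w ≡ p ++ v ∷ q → lab w ≢ S →
    Walk G (Below (p ∷ʳ v)) (λ z → z ↣ v × lab z ≡ zer) w
  ES-cond-walk E p q = go q (reverseView q)
    where
    anyEdge : ∀ {v} → ZeroEdgeTo v ⊆ λ z → z ↣ v × lab z ≡ zer
    anyEdge (e , labz) = (0 , e) , labz
    go : ∀ {w v} q → Reverse q → P w ≡ p ++ v ∷ q → lab w ≢ S →
      Walk G (Below (p ∷ʳ v)) (λ z → z ↣ v × lab z ≡ zer) w
    go .[] [] eq labw≢S = Walk-map G id anyEdge (ES-walk E p eq labw≢S)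
    go {w} {v} .(q ∷ʳ u) (q ∶ rq ∶ʳ u) eq labw≢S =
      Walk-++ G (Walk-map G (Below-∷ʳ p v q u) (λ e → 0 , proj₁ e) toU)
        (go q rq (P-entry (p ++ v ∷ q) u [] eq′) labu≢S)
      where
      eq′ : P w ≡ (p ++ v ∷ q) ∷ʳ u
      eq′ = reassoc p v q u eq
      toU : Walk G (Below ((p ++ v ∷ q) ∷ʳ u)) (ZeroEdgeTo u) w
      toU = ES-walk E (p ++ v ∷ q) eq′ labw≢S
      labu≢S : lab u ≢ S
      labu≢S labu≡S with Walk-last G toU
      ... | z , e , labz with trans (sym (proj₁ (zer-0 z u labz e))) labu≡S
      ... | ()

  EagerScope⇒Cond : EagerScope G P → EagerScopeCond G P
  EagerScope⇒Cond E w v p q eq labw≢S with Walk⇒path G (ES-cond-walk E p q eq labw≢S)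
  ... | n , ws , path , (e , labz) , below = n , ws , path , e , labz , below

  Cond⇒EagerScope : EagerScopeCond G P → EagerScope G P
  Cond⇒EagerScope C w v p eq labw≢S with C w v p [] eq labw≢S
  ... | n , ws , path , e , labz , below =
    n , ws , path , unary-edge G (cong arity labz) e , labz , λ i _ i<n → below i (<⇒≤ i<n)

  FullyBackLinked⇒Cond : FullyBackLinked G P → FullyBackLinkedCond G P
  FullyBackLinked⇒Cond F w v p q eq = Walk⇒path G (FBL-walk F p q eq)

  Cond⇒FullyBackLinked : FullyBackLinkedCond G P → FullyBackLinked G P
  Cond⇒FullyBackLinked C w v p = C w v p []

proposition7p5 : (G : TermGraph) (P : TermGraph.V G → List (TermGraph.V G)) →
    IsAbsPrefix G P →
    (EagerScope G P ⇔ EagerScopeCond G P) × (FullyBackLinked G P ⇔ FullyBackLinkedCond G P)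
proposition7p5 G P AP =
  mk⇔ (EagerScope⇒Cond G P AP) (Cond⇒EagerScope G P AP) ,
  mk⇔ (FullyBackLinked⇒Cond G P AP) (Cond⇒FullyBackLinked G P AP)
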